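{- Let $t\ge1$ and $G\in\mathscr{N}_t$. Then $G$ has at most $2t-1$ vertices of degree one. Moreover, $G$ has exactly $2t-1$ vertices of degree one if and only if $G$ has $2t-1$ vertices of degree one whose neighbours are pairwise distinct and deleting these $2t-1$ degree-one vertices leaves a complete graph.
   Context: All graphs are finite and simple with nonempty vertex set. By convention $K_1$ and $K_2$ are regarded as Hamiltonian (in addition to graphs with a Hamiltonian cycle). $G\ast H$ is the join ($G\sqcup H$ plus all edges between $V(G)$ and $V(H)$); $K_0$ is the empty graph. A vertex $v$ is universal if $\deg(v)=|V(G)|-1$. $\check{\mu}(G)=\min\{l\in\mathbb{N}_0: K_l\ast G\text{ is Hamiltonian}\}$. $\mathscr{M}_t$ is the set of graphs $G$ with $\check{\mu}(G)=t$ and $\check{\mu}(G+e)<t$ for every non-edge $e$ of $G$; $\mathscr{N}_t$ ($t\ge1$) is the set of connected graphs in $\mathscr{M}_t$ with no universal vertex. -}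

module Defs where

open import Data.Nat using (ℕ; zero; suc; _+_; _*_; _∸_; _≤_; _<_)
open import Data.Nat.Base using (_≡ᵇ_)
open import Data.Fin using (Fin; zero; suc; splitAt; inject₁; fromℕ; _≟_)
open import Data.Bool using (Bool; true; false; not; _∨_; _∧_)
open import Data.List using (List; length; filterᵇ; allFin)
open import Data.Sum using (_⊎_; inj₁; inj₂)
open import Data.Product using (_×_; Σ; ∃; ∃-syntax; _,_)
open import Relation.Nullary using (¬_)
open import Relation.Nullary.Decidable using (⌊_⌋)
open import Relation.Binary.PropositionalEquality using (_≡_; _≢_)
open import Function.Definitions using (Injective)

Adj : ℕ → Set
Adj n = Fin n → Fin n → Bool

record Graph (n : ℕ) : Set where
  field
    adj    : Adj n
    sym    : ∀ u v → adj u v ≡ adj v u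
    irrefl : ∀ u → adj u u ≡ false
open Graph public

-- Join K_l * A on vertex set Fin (l + n): first l vertices form K_l,
-- all edges between K_l and A are added.
join : ∀ {n} (l : ℕ) → Adj n → Adj (l + n)
join {n} l A x y with splitAt l x | splitAt l y
... | inj₁ a | inj₁ b = not ⌊ a ≟ b ⌋
... | inj₁ _ | inj₂ _ = true
... | inj₂ _ | inj₁ _ = true
... | inj₂ a | inj₂ b = A a b

addEdge : ∀ {n} → Adj n → Fin n → Fin n → Adj n
addEdge A u v x y =
  A x y ∨ ((⌊ x ≟ u ⌋ ∧ ⌊ y ≟ v ⌋) ∨ (⌊ x ≟ v ⌋ ∧ ⌊ y ≟ u ⌋))

-- Hamiltonian: K_1, K_2, or (n ≥ 3) has a Hamiltonian cycle, given by an
-- injective (hence bijective) enumeration σ of the vertices with consecutive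
-- vertices adjacent and the last adjacent to the first.
data Hamiltonian : {n : ℕ} → Adj n → Set where
  k1  : (A : Adj 1) → Hamiltonian A
  k2  : (A : Adj 2) → A zero (suc zero) ≡ true → Hamiltonian A
  cyc : ∀ {m} (A : Adj (suc m)) → 2 ≤ m →
        (σ : Fin (suc m) → Fin (suc m)) → Injective _≡_ _≡_ σ →
        (∀ (i : Fin m) → A (σ (inject₁ i)) (σ (suc i)) ≡ true) →
        A (σ (fromℕ m)) (σ zero) ≡ true →
        Hamiltonian A

MuIs : ∀ {n} → Adj n → ℕ → Set
MuIs A t = Hamiltonian (join t A) × (∀ l → l < t → ¬ Hamiltonian (join l A))

InM : ∀ {n} → Graph n → ℕ → Set
InM G t = MuIs (adj G) t ×
  (∀ u v → u ≢ v → adj G u v ≡ false →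
     ∃[ s ] (s < t × MuIs (addEdge (adj G) u v) s))

deg : ∀ {n} → Graph n → Fin n → ℕ
deg {n} G u = length (filterᵇ (adj G u) (allFin n))

data Reach {n} (G : Graph n) : Fin n → Fin n → Set where
  here : ∀ {u} → Reach G u u
  step : ∀ {u v w} → adj G u v ≡ true → Reach G v w → Reach G u w

Connected : ∀ {n} → Graph n → Set
Connected {n} G = ∀ (u v : Fin n) → Reach G u v

Universal : ∀ {n} → Graph n → Fin n → Set
Universal {n} G u = deg G u ≡ n ∸ 1

InN : ∀ {n} → Graph n → ℕ → Set
InN G t = Connected G × InM G t × (∀ u → ¬ Universal G u)

numDeg1 : ∀ {n} → Graph n → ℕ
numDeg1 {n} G = length (filterᵇ (λ v → deg G v ≡ᵇ 1) (allFin n))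

GoodLeaves : ∀ {n} → Graph n → ℕ → Set
GoodLeaves {n} G k =
  Σ (Fin k → Fin n) λ f → Σ (Fin k → Fin n) λ g →
    Injective _≡_ _≡_ f ×
    (∀ i → deg G (f i) ≡ 1) ×
    (∀ i → adj G (f i) (g i) ≡ true) ×
    Injective _≡_ _≡_ g ×
    (∀ u v → (∀ i → f i ≢ u) → (∀ i → f i ≢ v) → u ≢ v → adj G u v ≡ true)

-- Let t = μ̌(G). For a non-edge uw of G, G ∈ 𝓜_t gives μ̌(G + uw) = s < t, i.e. a Hamiltonian
-- cycle of K_s ∗ (G + uw). A vertex of G + uw with at most one neighbour there cannot have both
-- cycle-neighbours inside G + uw, so it is an end of a cycle edge into K_s; as every vertex of K_s
-- lies on exactly two cycle edges, there are at most 2s ≤ 2t − 2 such vertices. All leaves of G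
-- other than u and w are such vertices. Taking u a leaf and w a non-leaf other than its neighbour
-- (one exists, as otherwise that neighbour would be universal) bounds the leaves by 2t − 1.
-- If there are exactly 2t − 1 leaves, the same count shows that the non-leaves are pairwise
-- adjacent. And if two leaves x, x′ had a common neighbour y, pick a non-neighbour w of y: the
-- count forces x and x′ to be the two cycle-neighbours of y in K_s ∗ (G + yw), so the cycle avoids
-- yw and K_s ∗ G is already Hamiltonian, contradicting μ̌(G) = t > s.

module Submission where

open import Defs hiding (sym)
open import Data.Bool as Bool using (Bool; true; false; not; _∨_; _∧_)
open import Data.Bool.Properties using (T-≡; ¬-not; ∨-identityʳ; ∨-comm; ∧-comm)
open import Data.Empty using (⊥; ⊥-elim)
open import Data.Fin using (Fin; zero; suc; fromℕ; inject₁; toℕ; punchIn; punchOut; _↑ˡ_; _↑ʳ_; splitAt)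
open import Data.Fin.Properties
  using (_≟_; any?; injective⇒≤; 0≢1+n; punchIn-injective; punchInᵢ≢i; punchOut-injective;
         fromℕ≢inject₁; inject₁-injective; toℕ-inject₁; ↑ˡ-injective; ↑ʳ-injective;
         splitAt-↑ˡ; splitAt-↑ʳ; splitAt⁻¹-↑ˡ; splitAt⁻¹-↑ʳ)
  renaming (suc-injective to fsuc-injective)
open import Data.List using (List; length; lookup; filterᵇ; allFin)
open import Data.List.Membership.Propositional using (_∈_)
open import Data.List.Membership.Propositional.Properties using (∈-filter⁺; ∈-filter⁻; ∈-allFin; ∈-lookup)
open import Data.List.Relation.Unary.All as All using ()
open import Data.List.Relation.Unary.AllPairs using (_∷_)
open import Data.List.Relation.Unary.Any using (index)
open import Data.List.Relation.Unary.Any.Properties using (lookup-index)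
open import Data.List.Relation.Unary.Unique.Propositional using (Unique)
open import Data.List.Relation.Unary.Unique.Propositional.Properties using (allFin⁺; filter⁺)
open import Data.Nat as ℕ using (ℕ; suc; _+_; _*_; _∸_; _≤_; _<_; z≤n; s≤s)
open import Data.Nat.Properties
  using (≤-trans; ≤-antisym; <-irrefl; +-mono-≤; m≤n+m; 1+n≰n; m≢1+n+m; +-suc; +-identityʳ; ≡ᵇ⇒≡; ≡⇒≡ᵇ)
open import Data.Product using (Σ; ∃; ∃-syntax; _×_; _,_; proj₁; proj₂)
open import Data.Sum using (_⊎_; inj₁; inj₂)
open import Function using (_∘_)
open import Function.Bundles using (_⇔_; mk⇔; Equivalence)
open import Function.Definitions using (Injective)
open import Relation.Binary.PropositionalEquality
  using (_≡_; _≢_; refl; sym; trans; cong; cong₂; subst; module ≡-Reasoning)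
open import Relation.Nullary using (¬_; yes; no)
open import Relation.Nullary.Decidable using (⌊_⌋; T?; ¬?; _×-dec_; decidable-stable)

lookup-injective : ∀ {A : Set} {xs : List A} → Unique xs → Injective _≡_ _≡_ (lookup xs)
lookup-injective (_ ∷ _)   {zero}  {zero}  _  = refl
lookup-injective (x∉ ∷ _)  {zero}  {suc j} eq = ⊥-elim (All.lookup x∉ (∈-lookup j) eq)
lookup-injective (x∉ ∷ _)  {suc i} {zero}  eq = ⊥-elim (All.lookup x∉ (∈-lookup i) (sym eq))
lookup-injective (_ ∷ xs!) {suc i} {suc j} eq = cong suc (lookup-injective xs! eq)

module _ {n : ℕ} (p : Fin n → Bool) where

  enumerate : Fin (length (filterᵇ p (allFin n))) → Fin n
  enumerate = lookup (filterᵇ p (allFin n))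

  enumerate-injective : Injective _≡_ _≡_ enumerate
  enumerate-injective = lookup-injective (filter⁺ (T? ∘ p) (allFin⁺ n))

  enumerate-sound : ∀ i → p (enumerate i) ≡ true
  enumerate-sound i = Equivalence.to T-≡ (proj₂ (∈-filter⁻ (T? ∘ p) {xs = allFin n} (∈-lookup i)))

  enumerate-complete : ∀ {v} → p v ≡ true → ∃ λ i → enumerate i ≡ v
  enumerate-complete {v} pv = index v∈ , sym (lookup-index v∈)
    where
    v∈ : v ∈ filterᵇ p (allFin n)
    v∈ = ∈-filter⁺ (T? ∘ p) (∈-allFin v) (Equivalence.from T-≡ pv)

  injective⇒≤-length-filterᵇ : ∀ {k} {f : Fin k → Fin n} → Injective _≡_ _≡_ f →
    (∀ i → p (f i) ≡ true) → k ≤ length (filterᵇ p (allFin n))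
  injective⇒≤-length-filterᵇ {k} {f} f-inj pf = injective⇒≤ {f = position} position-injective
    where
    position : Fin k → Fin (length (filterᵇ p (allFin n)))
    position i = proj₁ (enumerate-complete (pf i))
    position-injective : Injective _≡_ _≡_ position
    position-injective {i} {j} eq = f-inj (trans (sym (proj₂ (enumerate-complete (pf i))))
      (trans (cong enumerate eq) (proj₂ (enumerate-complete (pf j)))))

  length-filterᵇ≡1⇒∃! : length (filterᵇ p (allFin n)) ≡ 1 →
    ∃[ y ] p y ≡ true × (∀ {z} → p z ≡ true → z ≡ y)
  length-filterᵇ≡1⇒∃! = singleton enumerate enumerate-sound enumerate-complete
    where
    singleton : ∀ {k} (e : Fin k → Fin n) → (∀ i → p (e i) ≡ true) →
      (∀ {z} → p z ≡ true → ∃ λ i → e i ≡ z) → k ≡ 1 → ∃[ y ] p y ≡ true × (∀ {z} → p z ≡ true → z ≡ y)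
    singleton e sound complete refl = e zero , sound zero , λ pz → image⇒≡ (complete pz)
      where
      image⇒≡ : ∀ {z} → ∃ (λ i → e i ≡ z) → z ≡ e zero
      image⇒≡ (zero , ez≡z) = sym ez≡z

length-filterᵇ-allBut : ∀ {m} (p : Fin (suc m) → Bool) y → p y ≡ false → (∀ v → v ≢ y → p v ≡ true) →
  length (filterᵇ p (allFin (suc m))) ≡ m
length-filterᵇ-allBut p y py≡false others = ≤-antisym
  (injective⇒≤ {f = λ i → punchOut (y≢enumerate i)} λ eq →
    enumerate-injective p (punchOut-injective (y≢enumerate _) (y≢enumerate _) eq))
  (injective⇒≤-length-filterᵇ p (punchIn-injective y _ _) (λ i → others (punchIn y i) (punchInᵢ≢i y i)))
  where
  y≢enumerate : ∀ i → y ≢ enumerate p i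
  y≢enumerate i y≡ with () ← trans (sym py≡false) (trans (cong p y≡) (enumerate-sound p i))

injective⇒preimage : ∀ {n} {f : Fin n → Fin n} → Injective _≡_ _≡_ f → ∀ v → ∃ λ u → f u ≡ v
injective⇒preimage {suc n} {f} f-injective v with any? (λ u → f u ≟ v)
... | yes found = found
... | no missed = ⊥-elim (<-irrefl refl (injective⇒≤ {f = g} g-injective))
  where
  v≢f : ∀ u → v ≢ f u
  v≢f u v≡fu = missed (u , sym v≡fu)
  g : Fin (suc n) → Fin n
  g u = punchOut (v≢f u)
  g-injective : Injective _≡_ _≡_ g
  g-injective eq = f-injective (punchOut-injective (v≢f _) (v≢f _) eq)

module _ {n : ℕ} {f : Fin n → Fin n} (f-injective : Injective _≡_ _≡_ f) where

  inverse : Fin n → Fin n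
  inverse v = proj₁ (injective⇒preimage f-injective v)

  inverseʳ : ∀ v → f (inverse v) ≡ v
  inverseʳ v = proj₂ (injective⇒preimage f-injective v)

  inverseˡ : ∀ u → inverse (f u) ≡ u
  inverseˡ u = f-injective (inverseʳ (f u))

omitPreimage : ∀ {n k} {f : Fin (suc k) → Fin n} → Injective _≡_ _≡_ f → ∀ w →
  ∃[ h ] Injective _≡_ _≡_ h × (∀ i → f (h i) ≢ w)
omitPreimage {f = f} f-injective w with any? (λ j → f j ≟ w)
... | yes (j , fj≡w) = punchIn j , punchIn-injective j _ _ ,
                       λ i fh≡w → punchInᵢ≢i j i (f-injective (trans fh≡w (sym fj≡w)))
... | no none        = suc , fsuc-injective , λ i fsi≡w → none (suc i , fsi≡w)

cyclicPred : ∀ {m} → Fin (suc m) → Fin (suc m)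
cyclicPred {m} zero = fromℕ m
cyclicPred (suc i) = inject₁ i

cyclicPred-injective : ∀ {m} → Injective _≡_ _≡_ (cyclicPred {m})
cyclicPred-injective {x = zero}  {zero}  _  = refl
cyclicPred-injective {x = zero}  {suc j} eq = ⊥-elim (fromℕ≢inject₁ eq)
cyclicPred-injective {x = suc i} {zero}  eq = ⊥-elim (fromℕ≢inject₁ (sym eq))
cyclicPred-injective {x = suc i} {suc j} eq = cong suc (inject₁-injective eq)

cyclicPred²≢id : ∀ {m} → 2 ≤ m → ∀ p → cyclicPred (cyclicPred {m} p) ≢ p
cyclicPred²≢id {suc ℕ.zero} (s≤s ()) _
cyclicPred²≢id {suc (suc _)} _ zero ()
cyclicPred²≢id {suc (suc _)} _ (suc zero) ()
cyclicPred²≢id {suc (suc _)} _ (suc (suc i)) eq =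
  m≢1+n+m (toℕ i) (trans (sym (trans (toℕ-inject₁ (inject₁ i)) (toℕ-inject₁ i))) (cong toℕ eq))

record Cycle (N : ℕ) : Set where
  field
    next prev : Fin N → Fin N
    prev-next : ∀ v → prev (next v) ≡ v
    next-prev : ∀ v → next (prev v) ≡ v
    next≢prev : ∀ v → next v ≢ prev v
    spans     : (B : Adj N) → (∀ v → B v (next v) ≡ true) → Hamiltonian B

  next-injective : Injective _≡_ _≡_ next
  next-injective {u} {v} eq = trans (sym (prev-next u)) (trans (cong prev eq) (prev-next v))

  prev-injective : Injective _≡_ _≡_ prev
  prev-injective {u} {v} eq = trans (sym (next-prev u)) (trans (cong next eq) (next-prev v))

  Adjacent : Fin N → Fin N → Set
  Adjacent u v = u ≡ next v ⊎ u ≡ prev v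

  next≡⇒adjacent : ∀ {u v} → next u ≡ v → Adjacent u v
  next≡⇒adjacent {u} refl = inj₂ (sym (prev-next u))

  prev≡⇒adjacent : ∀ {u v} → prev u ≡ v → Adjacent u v
  prev≡⇒adjacent {u} refl = inj₁ (sym (next-prev u))

  no-three-adjacent : ∀ {a b c v} → a ≢ b → a ≢ c → b ≢ c → Adjacent a v → Adjacent b v → ¬ Adjacent c v
  no-three-adjacent a≢b _   _   (inj₁ refl) (inj₁ refl) _           = a≢b refl
  no-three-adjacent a≢b _   _   (inj₂ refl) (inj₂ refl) _           = a≢b refl
  no-three-adjacent _   a≢c _   (inj₁ refl) (inj₂ refl) (inj₁ refl) = a≢c refl
  no-three-adjacent _   _   b≢c (inj₁ refl) (inj₂ refl) (inj₂ refl) = b≢c refl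
  no-three-adjacent _   _   b≢c (inj₂ refl) (inj₁ refl) (inj₁ refl) = b≢c refl
  no-three-adjacent _   a≢c _   (inj₂ refl) (inj₁ refl) (inj₂ refl) = a≢c refl

hamiltonian⇒cycle : ∀ {N} {B : Adj N} → Hamiltonian B → 3 ≤ N →
  Σ (Cycle N) λ C → ∀ v → B v (Cycle.next C v) ≡ true
hamiltonian⇒cycle (k1 _) (s≤s ())
hamiltonian⇒cycle (k2 _ _) (s≤s (s≤s ()))
hamiltonian⇒cycle (cyc {m} B 2≤m σ σ-injective steps closing) _ = cycle , edges-along B around
  where
  cyclicSucc : Fin (suc m) → Fin (suc m)
  cyclicSucc = inverse cyclicPred-injective
  position : Fin (suc m) → Fin (suc m)
  position = inverse σ-injective

  next prev : Fin (suc m) → Fin (suc m)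
  next v = σ (cyclicSucc (position v))
  prev v = σ (cyclicPred (position v))

  around : ∀ q → B (σ (cyclicPred q)) (σ q) ≡ true
  around zero    = closing
  around (suc i) = steps i

  edges-along : ∀ (B' : Adj (suc m)) → (∀ q → B' (σ (cyclicPred q)) (σ q) ≡ true) → ∀ v → B' v (next v) ≡ true
  edges-along B' along v = subst (λ u → B' u (next v) ≡ true)
    (trans (cong σ (inverseʳ cyclicPred-injective (position v))) (inverseʳ σ-injective v))
    (along (cyclicSucc (position v)))

  edges-along⁻ : ∀ (B' : Adj (suc m)) → (∀ v → B' v (next v) ≡ true) → ∀ q → B' (σ (cyclicPred q)) (σ q) ≡ true
  edges-along⁻ B' along q = subst (λ p → B' (σ (cyclicPred q)) (σ p) ≡ true)
    (trans (cong cyclicSucc (inverseˡ σ-injective (cyclicPred q))) (inverseˡ cyclicPred-injective q))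
    (along (σ (cyclicPred q)))

  cycle : Cycle (suc m)
  cycle = record
    { next = next
    ; prev = prev
    ; prev-next = λ v → begin
        σ (cyclicPred (position (σ (cyclicSucc (position v))))) ≡⟨ cong (σ ∘ cyclicPred) (inverseˡ σ-injective _) ⟩
        σ (cyclicPred (cyclicSucc (position v)))                 ≡⟨ cong σ (inverseʳ cyclicPred-injective _) ⟩
        σ (position v)                                            ≡⟨ inverseʳ σ-injective v ⟩
        v                                                         ∎
    ; next-prev = λ v → begin
        σ (cyclicSucc (position (σ (cyclicPred (position v))))) ≡⟨ cong (σ ∘ cyclicSucc) (inverseˡ σ-injective _) ⟩
        σ (cyclicSucc (cyclicPred (position v)))                 ≡⟨ cong σ (inverseˡ cyclicPred-injective _) ⟩
        σ (position v)                                            ≡⟨ inverseʳ σ-injective v ⟩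
        v                                                         ∎
    ; next≢prev = λ v eq → cyclicPred²≢id 2≤m (position v)
        (trans (cong cyclicPred (sym (σ-injective eq))) (inverseʳ cyclicPred-injective (position v)))
    ; spans = λ B' along →
        cyc B' 2≤m σ σ-injective (λ i → edges-along⁻ B' along (suc i)) (edges-along⁻ B' along zero)
    }
    where open ≡-Reasoning

Symmetric : ∀ {n} → Adj n → Set
Symmetric A = ∀ u v → A u v ≡ A v u

AtMostOneNeighbour : ∀ {n} → Adj n → Fin n → Set
AtMostOneNeighbour A v = ∀ {a b} → A v a ≡ true → A v b ≡ true → a ≡ b

private
  ≟∧≟≡false : ∀ {n} {a b u w : Fin n} → ¬ (a ≡ u × b ≡ w) → (⌊ a ≟ u ⌋ ∧ ⌊ b ≟ w ⌋) ≡ false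
  ≟∧≟≡false {a = a} {b} {u} {w} ¬uw with a ≟ u | b ≟ w
  ... | yes a≡u | yes b≡w = ⊥-elim (¬uw (a≡u , b≡w))
  ... | yes _   | no _    = refl
  ... | no _    | _       = refl

module _ {n : ℕ} {A : Adj n} {u w : Fin n} where

  addEdge-≡ : ∀ {a b} → ¬ (a ≡ u × b ≡ w) → ¬ (a ≡ w × b ≡ u) → addEdge A u w a b ≡ A a b
  addEdge-≡ {a} {b} ¬uw ¬wu rewrite ≟∧≟≡false ¬uw | ≟∧≟≡false ¬wu = ∨-identityʳ (A a b)

  addEdge-≡-row : ∀ {v} b → v ≢ u → v ≢ w → addEdge A u w v b ≡ A v b
  addEdge-≡-row b v≢u v≢w = addEdge-≡ (λ (v≡u , _) → v≢u v≡u) (λ (v≡w , _) → v≢w v≡w)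

  addEdge-sym : Symmetric A → Symmetric (addEdge A u w)
  addEdge-sym A-sym a b rewrite A-sym a b =
    cong (A b a ∨_) (trans (∨-comm (⌊ a ≟ u ⌋ ∧ ⌊ b ≟ w ⌋) _)
      (cong₂ _∨_ (∧-comm ⌊ a ≟ w ⌋ _) (∧-comm ⌊ a ≟ u ⌋ _)))

module _ {n : ℕ} (l : ℕ) where

  ↑ˡ≢↑ʳ : ∀ (k : Fin l) (a : Fin n) → k ↑ˡ n ≢ l ↑ʳ a
  ↑ˡ≢↑ʳ k a eq with () ← trans (sym (splitAt-↑ˡ l k n)) (trans (cong (splitAt l) eq) (splitAt-↑ʳ l n a))

  ↑ˡ⊎↑ʳ : ∀ z → (∃ λ k → z ≡ k ↑ˡ n) ⊎ (∃ λ a → z ≡ l ↑ʳ a)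
  ↑ˡ⊎↑ʳ z with splitAt l z in eq
  ... | inj₁ k = inj₁ (k , sym (splitAt⁻¹-↑ˡ eq))
  ... | inj₂ a = inj₂ (a , sym (splitAt⁻¹-↑ʳ eq))

  join-↑ʳ : ∀ (A : Adj n) a b → join l A (l ↑ʳ a) (l ↑ʳ b) ≡ A a b
  join-↑ʳ A a b rewrite splitAt-↑ʳ l n a | splitAt-↑ʳ l n b = refl

  join-sym : ∀ {A : Adj n} → Symmetric A → Symmetric (join l A)
  join-sym A-sym x y with splitAt l x | splitAt l y
  ... | inj₁ a | inj₁ b = cong not (≟-sym a b)
    where
    ≟-sym : ∀ (a b : Fin l) → ⌊ a ≟ b ⌋ ≡ ⌊ b ≟ a ⌋
    ≟-sym a b with a ≟ b | b ≟ a
    ... | yes _    | yes _    = refl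
    ... | no _     | no _     = refl
    ... | yes a≡b  | no b≢a   = ⊥-elim (b≢a (sym a≡b))
    ... | no a≢b   | yes b≡a  = ⊥-elim (a≢b (sym b≡a))
  ... | inj₁ _ | inj₂ _ = refl
  ... | inj₂ _ | inj₁ _ = refl
  ... | inj₂ a | inj₂ b = A-sym a b

  join-addEdge⁻ : ∀ {A : Adj n} {u w x z} → join l (addEdge A u w) x z ≡ true →
    ¬ (x ≡ l ↑ʳ u × z ≡ l ↑ʳ w) → ¬ (x ≡ l ↑ʳ w × z ≡ l ↑ʳ u) → join l A x z ≡ true
  join-addEdge⁻ {A} {u} {w} {x} {z} edge ¬uw ¬wu with splitAt l x in ex | splitAt l z in ez
  ... | inj₁ _ | inj₁ _ = edge
  ... | inj₁ _ | inj₂ _ = refl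
  ... | inj₂ _ | inj₁ _ = refl
  ... | inj₂ a | inj₂ b = trans (sym (addEdge-≡ {A = A} ¬uw' ¬wu')) edge
    where
    x≡ : x ≡ l ↑ʳ a
    x≡ = sym (splitAt⁻¹-↑ʳ ex)
    z≡ : z ≡ l ↑ʳ b
    z≡ = sym (splitAt⁻¹-↑ʳ ez)
    ¬uw' : ¬ (a ≡ u × b ≡ w)
    ¬uw' (refl , refl) = ¬uw (x≡ , z≡)
    ¬wu' : ¬ (a ≡ w × b ≡ u)
    ¬wu' (refl , refl) = ¬wu (x≡ , z≡)

module PendantBound {n l : ℕ} {A : Adj n} (A-sym : Symmetric A) (C : Cycle (l + n))
  (along : ∀ v → join l A v (Cycle.next C v) ≡ true) where

  open Cycle C

  along-prev : ∀ v → join l A v (prev v) ≡ true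
  along-prev v = trans (join-sym l A-sym v (prev v))
    (subst (λ u → join l A (prev v) u ≡ true) (next-prev v) (along (prev v)))

  next-↑ʳ⇒edge : ∀ {v a} → next (l ↑ʳ v) ≡ l ↑ʳ a → A v a ≡ true
  next-↑ʳ⇒edge {v} {a} eq =
    trans (sym (join-↑ʳ l A v a)) (subst (λ z → join l A (l ↑ʳ v) z ≡ true) eq (along (l ↑ʳ v)))

  prev-↑ʳ⇒edge : ∀ {v a} → prev (l ↑ʳ v) ≡ l ↑ʳ a → A v a ≡ true
  prev-↑ʳ⇒edge {v} {a} eq =
    trans (sym (join-↑ʳ l A v a)) (subst (λ z → join l A (l ↑ʳ v) z ≡ true) eq (along-prev (l ↑ʳ v)))

  -- A vertex with at most one A-neighbour has a cycle-neighbour in K_l; it is charged to that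
  -- cycle edge, encoded as k ↑ˡ l (edge to next) or l ↑ʳ k (edge from prev) for the K_l end k.
  data Anchor (v : Fin n) : Set where
    viaNext : ∀ k → next (l ↑ʳ v) ≡ k ↑ˡ n → Anchor v
    viaPrev : ∀ k → prev (l ↑ʳ v) ≡ k ↑ˡ n → ∀ a → next (l ↑ʳ v) ≡ l ↑ʳ a → Anchor v

  anchor : ∀ {v} → AtMostOneNeighbour A v → Anchor v
  anchor {v} amo with ↑ˡ⊎↑ʳ l (next (l ↑ʳ v))
  ... | inj₁ (k , eq) = viaNext k eq
  ... | inj₂ (a , eqa) with ↑ˡ⊎↑ʳ l (prev (l ↑ʳ v))
  ...   | inj₁ (k , eq) = viaPrev k eq a eqa
  ...   | inj₂ (b , eqb) = ⊥-elim (next≢prev (l ↑ʳ v) (trans eqa (trans (cong (l ↑ʳ_) a≡b) (sym eqb))))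
    where
    a≡b : a ≡ b
    a≡b = amo (next-↑ʳ⇒edge eqa) (prev-↑ʳ⇒edge eqb)

  slot : ∀ {v} → Anchor v → Fin (l + l)
  slot (viaNext k _)     = k ↑ˡ l
  slot (viaPrev k _ _ _) = l ↑ʳ k

  slot-injective : ∀ {v v'} (s : Anchor v) (s' : Anchor v') → slot s ≡ slot s' → v ≡ v'
  slot-injective (viaNext k eq) (viaNext k' eq') same with ↑ˡ-injective l k k' same
  ... | refl = ↑ʳ-injective l _ _ (next-injective (trans eq (sym eq')))
  slot-injective (viaNext k _) (viaPrev k' _ _ _) same = ⊥-elim (↑ˡ≢↑ʳ l k k' same)
  slot-injective (viaPrev k _ _ _) (viaNext k' _) same = ⊥-elim (↑ˡ≢↑ʳ l k' k (sym same))
  slot-injective (viaPrev k eq _ _) (viaPrev k' eq' _ _) same with ↑ʳ-injective l k k' same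
  ... | refl = ↑ʳ-injective l _ _ (prev-injective (trans eq (sym eq')))

  module _ {k} {S : Fin k → Fin n} (S-injective : Injective _≡_ _≡_ S)
           (S-pendant : ∀ i → AtMostOneNeighbour A (S i)) where

    private
      slotOf : Fin k → Fin (l + l)
      slotOf i = slot (anchor (S-pendant i))

      slotOf-injective : Injective _≡_ _≡_ slotOf
      slotOf-injective same = S-injective (slot-injective (anchor (S-pendant _)) (anchor (S-pendant _)) same)

    pendants≤ : k ≤ l + l
    pendants≤ = injective⇒≤ slotOf-injective

    pendants< : ∀ {x q₁ q₂} → next (l ↑ʳ x) ≡ q₁ ↑ˡ n → prev (l ↑ʳ x) ≡ q₂ ↑ˡ n → suc k ≤ l + l
    pendants< {x} {q₁} {q₂} next≡ prev≡ = injective⇒≤ {f = slots} slots-injective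
      where
      -- A vertex takes the prev-slot of q₂ only if its next lies outside K_l, so x is not one of them.
      slot-free : ∀ {v} (s : Anchor v) → slot s ≢ l ↑ʳ q₂
      slot-free (viaNext k _) = ↑ˡ≢↑ʳ l k q₂
      slot-free {v} (viaPrev k eq a eqa) same with ↑ʳ-injective l k q₂ same
      ... | refl with ↑ʳ-injective l v x (prev-injective (trans eq (sym prev≡)))
      ...   | refl = ↑ˡ≢↑ʳ l q₁ a (trans (sym next≡) eqa)
      slots : Fin (suc k) → Fin (l + l)
      slots zero    = l ↑ʳ q₂
      slots (suc i) = slotOf i
      slots-injective : Injective _≡_ _≡_ slots
      slots-injective {zero}  {zero}  _    = refl
      slots-injective {zero}  {suc j} same = ⊥-elim (slot-free (anchor (S-pendant j)) (sym same))
      slots-injective {suc i} {zero}  same = ⊥-elim (slot-free (anchor (S-pendant i)) same)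
      slots-injective {suc i} {suc j} same = cong suc (slotOf-injective same)

Leaf : ∀ {n} → Graph n → Fin n → Set
Leaf G v = deg G v ≡ 1

module _ {n : ℕ} (G : Graph n) where

  adjacent⇒≢ : ∀ {a b} → adj G a b ≡ true → a ≢ b
  adjacent⇒≢ {a} ab refl with () ← trans (sym ab) (irrefl G a)

  leaf⇒neighbour : ∀ {v} → Leaf G v → ∃[ y ] adj G v y ≡ true × (∀ {z} → adj G v z ≡ true → z ≡ y)
  leaf⇒neighbour {v} = length-filterᵇ≡1⇒∃! (adj G v)

  leaf⇒atMostOneNeighbour : ∀ {v} → Leaf G v → AtMostOneNeighbour (adj G) v
  leaf⇒atMostOneNeighbour v-leaf va vb with _ , _ , only ← leaf⇒neighbour v-leaf =
    trans (only va) (sym (only vb))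

  isLeaf : Fin n → Bool
  isLeaf v = deg G v ℕ.≡ᵇ 1

  leaves : Fin (numDeg1 G) → Fin n
  leaves = enumerate isLeaf

  leaves-injective : Injective _≡_ _≡_ leaves
  leaves-injective = enumerate-injective isLeaf

  leaves-leaf : ∀ i → Leaf G (leaves i)
  leaves-leaf i = ≡ᵇ⇒≡ _ 1 (Equivalence.from T-≡ (enumerate-sound isLeaf i))

  injective⇒≤-numDeg1 : ∀ {k} {f : Fin k → Fin n} → Injective _≡_ _≡_ f → (∀ i → Leaf G (f i)) → k ≤ numDeg1 G
  injective⇒≤-numDeg1 f-injective f-leaf =
    injective⇒≤-length-filterᵇ isLeaf f-injective λ i → Equivalence.to T-≡ (≡⇒≡ᵇ _ 1 (f-leaf i))

  reach-preserves : (P : Fin n → Set) → (∀ {a b} → P a → adj G a b ≡ true → P b) →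
    ∀ {u v} → Reach G u v → P u → P v
  reach-preserves P preserves here        Pu = Pu
  reach-preserves P preserves (step ab r) Pu = reach-preserves P preserves r (preserves Pu ab)

module _ {m : ℕ} (G : Graph (suc m)) where

  allAdjacent⇒universal : ∀ y → (∀ w → w ≢ y → adj G y w ≡ true) → Universal G y
  allAdjacent⇒universal y = length-filterᵇ-allBut (adj G y) y (irrefl G y)

  nonUniversal⇒nonNeighbour : ∀ {y} → ¬ Universal G y → ∃[ w ] w ≢ y × adj G y w ≡ false
  nonUniversal⇒nonNeighbour {y} ¬universal with any? (λ w → ¬? (w ≟ y) ×-dec (adj G y w Bool.≟ false))
  ... | yes found = found
  ... | no none   = ⊥-elim (¬universal (allAdjacent⇒universal y λ w w≢y →
                      ¬-not (λ yw → none (w , w≢y , yw))))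

  leavesAround⇒universal : Connected G → ∀ {y} → (∀ v → v ≢ y → Leaf G v) → Universal G y
  leavesAround⇒universal connected {y} leaves = allAdjacent⇒universal y adjacentToY
    where
    NearY : Fin (suc m) → Set
    NearY a = a ≡ y ⊎ adj G a y ≡ true
    preserves : ∀ {a b} → NearY a → adj G a b ≡ true → NearY b
    preserves (inj₁ refl) ab = inj₂ (trans (Graph.sym G _ _) ab)
    preserves {a} (inj₂ ay) ab = inj₁ (leaf⇒atMostOneNeighbour G (leaves a (adjacent⇒≢ G ay)) ab ay)
    adjacentToY : ∀ w → w ≢ y → adj G y w ≡ true
    adjacentToY w w≢y with reach-preserves G NearY preserves (connected y w) (inj₁ refl)
    ... | inj₁ w≡y = ⊥-elim (w≢y w≡y)
    ... | inj₂ wy  = trans (Graph.sym G y w) wy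

connected⇒3≤order : ∀ {m} (G : Graph (suc m)) → Connected G → (∀ u → ¬ Universal G u) → 3 ≤ suc m
connected⇒3≤order {ℕ.zero} G _ no-universal =
  ⊥-elim (no-universal zero (allAdjacent⇒universal G zero λ { zero 0≢0 → ⊥-elim (0≢0 refl) }))
connected⇒3≤order {suc ℕ.zero} G connected no-universal =
  ⊥-elim (no-universal zero (allAdjacent⇒universal G zero adjacentTo0))
  where
  firstStep : Reach G zero (suc zero) → adj G zero (suc zero) ≡ true
  firstStep (step {v = zero}     loop _) = ⊥-elim (adjacent⇒≢ G loop refl)
  firstStep (step {v = suc zero} edge _) = edge
  adjacentTo0 : ∀ w → w ≢ zero → adj G zero w ≡ true
  adjacentTo0 zero       0≢0 = ⊥-elim (0≢0 refl)
  adjacentTo0 (suc zero) _   = firstStep (connected zero (suc zero))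
connected⇒3≤order {suc (suc _)} _ _ _ = s≤s (s≤s (s≤s z≤n))

-- Here t' + 1 = μ̌(G).
module LeafBounds {m t' : ℕ} (G : Graph (suc m))
  (connected    : Connected G)
  (minimal      : ∀ l → l < suc t' → ¬ Hamiltonian (join l (adj G)))
  (saturated    : ∀ u v → u ≢ v → adj G u v ≡ false → ∃[ s ] (s < suc t' × MuIs (addEdge (adj G) u v) s))
  (no-universal : ∀ u → ¬ Universal G u)
  where

  private
    N : ℕ
    N = suc m
    A : Adj N
    A = adj G
    A-sym : Symmetric A
    A-sym = Graph.sym G

  cycleAfterAdding : ∀ {u w} → u ≢ w → A u w ≡ false →
    ∃[ s ] s ≤ t' × Σ (Cycle (s + N)) λ C → ∀ v → join s (addEdge A u w) v (Cycle.next C v) ≡ true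
  cycleAfterAdding u≢w uw∉ with saturated _ _ u≢w uw∉
  ... | s , s≤s s≤t' , hamiltonian , _ =
    s , s≤t' , hamiltonian⇒cycle hamiltonian (≤-trans (connected⇒3≤order G connected no-universal) (m≤n+m N s))

  leaf⇒atMostOneNeighbour-addEdge : ∀ {u w v} → v ≢ u → v ≢ w → Leaf G v → AtMostOneNeighbour (addEdge A u w) v
  leaf⇒atMostOneNeighbour-addEdge v≢u v≢w v-leaf va vb = leaf⇒atMostOneNeighbour G v-leaf
    (trans (sym (addEdge-≡-row {A = A} _ v≢u v≢w)) va) (trans (sym (addEdge-≡-row {A = A} _ v≢u v≢w)) vb)

  leavesAvoidingNonEdge≤ : ∀ {u w} → u ≢ w → A u w ≡ false →
    ∀ {k} {S : Fin k → Fin N} → Injective _≡_ _≡_ S → (∀ i → Leaf G (S i)) →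
    (∀ i → S i ≢ u) → (∀ i → S i ≢ w) → k ≤ t' + t'
  leavesAvoidingNonEdge≤ u≢w uw∉ S-injective S-leaf S≢u S≢w with cycleAfterAdding u≢w uw∉
  ... | s , s≤t' , C , along = ≤-trans
    (PendantBound.pendants≤ (addEdge-sym A-sym) C along S-injective
      (λ i → leaf⇒atMostOneNeighbour-addEdge (S≢u i) (S≢w i) (S-leaf i)))
    (+-mono-≤ s≤t' s≤t')

  leaves≤ : ∀ {k} {f : Fin k → Fin N} → Injective _≡_ _≡_ f → (∀ i → Leaf G (f i)) → k ≤ suc (t' + t')
  leaves≤ {ℕ.zero} _ _ = z≤n
  leaves≤ {suc k} {f} f-injective f-leaf
    with y , _ , onlyY ← leaf⇒neighbour G (f-leaf zero)
       | any? (λ z → ¬? (z ≟ y) ×-dec ¬? (deg G z ℕ.≟ 1))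
  ... | no none = ⊥-elim (no-universal y (leavesAround⇒universal G connected λ v v≢y →
          decidable-stable (deg G v ℕ.≟ 1) λ ¬leaf → none (v , v≢y , ¬leaf)))
  ... | yes (z , z≢y , z-nonLeaf) = s≤s (leavesAvoidingNonEdge≤ x≢z xz∉
          (fsuc-injective ∘ f-injective) (f-leaf ∘ suc)
          (λ i fsi≡x → 0≢1+n (sym (f-injective fsi≡x)))
          (λ i fsi≡z → z-nonLeaf (subst (Leaf G) fsi≡z (f-leaf (suc i)))))
    where
    x≢z : f zero ≢ z
    x≢z x≡z = z-nonLeaf (subst (Leaf G) x≡z (f-leaf zero))
    xz∉ : A (f zero) z ≡ false
    xz∉ = ¬-not (z≢y ∘ onlyY)

  module _ {f : Fin (suc (t' + t')) → Fin N} (f-injective : Injective _≡_ _≡_ f)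
           (f-leaf : ∀ i → Leaf G (f i)) where

    module AddedEdge {y w} (y-nonLeaf : ¬ Leaf G y) (yw∉ : A y w ≡ false)
      {s} (s≤t' : s ≤ t') (C : Cycle (s + N)) (along : ∀ v → join s (addEdge A y w) v (Cycle.next C v) ≡ true)
      where

      open Cycle C
      open PendantBound (addEdge-sym A-sym) C along

      neighbour≢w : ∀ {z} → A z y ≡ true → z ≢ w
      neighbour≢w zy refl with () ← trans (sym yw∉) (trans (A-sym y _) zy)

      private
        onlyNeighbourY : ∀ {z a} → Leaf G z → A z y ≡ true → addEdge A y w z a ≡ true → a ≡ y
        onlyNeighbourY z-leaf zy za = leaf⇒atMostOneNeighbour G z-leaf
          (trans (sym (addEdge-≡-row {A = A} _ (adjacent⇒≢ G zy) (neighbour≢w zy))) za) zy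

        -- z together with the 2t' leaves of f other than w would need 2t' + 1 slots, but 2s ≤ 2t'.
        cycleNeighbours∈K⇒⊥ : ∀ {z q₁ q₂} → next (s ↑ʳ z) ≡ q₁ ↑ˡ N → prev (s ↑ʳ z) ≡ q₂ ↑ˡ N → ⊥
        cycleNeighbours∈K⇒⊥ next≡q₁ prev≡q₂
          with h , h-injective , fh≢w ← omitPreimage f-injective w
          = 1+n≰n (≤-trans (pendants< (h-injective ∘ f-injective) fh-pendant next≡q₁ prev≡q₂)
                           (+-mono-≤ s≤t' s≤t'))
          where
          fh-pendant : ∀ i → AtMostOneNeighbour (addEdge A y w) (f (h i))
          fh-pendant i = leaf⇒atMostOneNeighbour-addEdge
            (λ fhi≡y → y-nonLeaf (subst (Leaf G) fhi≡y (f-leaf (h i)))) (fh≢w i) (f-leaf (h i))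

      leafNeighbour-adjacent : ∀ {z} → Leaf G z → A z y ≡ true → Adjacent (s ↑ʳ z) (s ↑ʳ y)
      leafNeighbour-adjacent {z} z-leaf zy with ↑ˡ⊎↑ʳ s (next (s ↑ʳ z)) | ↑ˡ⊎↑ʳ s (prev (s ↑ʳ z))
      ... | inj₂ (a , next≡a) | _ =
        next≡⇒adjacent (trans next≡a (cong (s ↑ʳ_) (onlyNeighbourY z-leaf zy (next-↑ʳ⇒edge next≡a))))
      ... | inj₁ _ | inj₂ (a , prev≡a) =
        prev≡⇒adjacent (trans prev≡a (cong (s ↑ʳ_) (onlyNeighbourY z-leaf zy (prev-↑ʳ⇒edge prev≡a))))
      ... | inj₁ (_ , next≡q₁) | inj₁ (_ , prev≡q₂) = ⊥-elim (cycleNeighbours∈K⇒⊥ next≡q₁ prev≡q₂)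

      nonAdjacent⇒hamiltonian : ¬ Adjacent (s ↑ʳ w) (s ↑ʳ y) → Hamiltonian (join s A)
      nonAdjacent⇒hamiltonian w≁y = spans (join s A) λ v → join-addEdge⁻ s (along v)
        (λ { (refl , next≡w) → w≁y (inj₁ (sym next≡w)) })
        (λ { (refl , next≡y) → w≁y (next≡⇒adjacent next≡y) })

    sharedNeighbour⇒≡ : ∀ {x x' y} → Leaf G x → Leaf G x' → A x y ≡ true → A x' y ≡ true → x ≡ x'
    sharedNeighbour⇒≡ {x} {x'} {y} x-leaf x'-leaf xy x'y = decidable-stable (x ≟ x') absurd
      where
      absurd : x ≢ x' → ⊥
      absurd x≢x'
        with w , w≢y , yw∉ ← nonUniversal⇒nonNeighbour G (no-universal y)
        with s , s≤t' , C , along ← cycleAfterAdding (w≢y ∘ sym) yw∉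
        = minimal s (s≤s s≤t') (nonAdjacent⇒hamiltonian w≁y)
        where
        y-nonLeaf : ¬ Leaf G y
        y-nonLeaf y-leaf =
          x≢x' (leaf⇒atMostOneNeighbour G y-leaf (trans (A-sym y x) xy) (trans (A-sym y x') x'y))
        open AddedEdge y-nonLeaf yw∉ s≤t' C along
        open Cycle C using (Adjacent; no-three-adjacent)
        w≁y : ¬ Adjacent (s ↑ʳ w) (s ↑ʳ y)
        w≁y = no-three-adjacent (x≢x' ∘ ↑ʳ-injective s _ _)
          (neighbour≢w xy ∘ ↑ʳ-injective s _ _) (neighbour≢w x'y ∘ ↑ʳ-injective s _ _)
          (leafNeighbour-adjacent x-leaf xy) (leafNeighbour-adjacent x'-leaf x'y)

    outside-adjacent : ∀ u v → (∀ i → f i ≢ u) → (∀ i → f i ≢ v) → u ≢ v → A u v ≡ true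
    outside-adjacent u v f≢u f≢v u≢v =
      ¬-not λ uv∉ → 1+n≰n (leavesAvoidingNonEdge≤ u≢v uv∉ f-injective f-leaf f≢u f≢v)

    goodLeaves : GoodLeaves G (suc (t' + t'))
    goodLeaves =
      f , neighbour , f-injective , f-leaf , neighbour-edge , neighbour-injective , outside-adjacent
      where
      neighbour : Fin (suc (t' + t')) → Fin N
      neighbour i = proj₁ (leaf⇒neighbour G (f-leaf i))
      neighbour-edge : ∀ i → A (f i) (neighbour i) ≡ true
      neighbour-edge i = proj₁ (proj₂ (leaf⇒neighbour G (f-leaf i)))
      neighbour-injective : Injective _≡_ _≡_ neighbour
      neighbour-injective {i} {j} same = f-injective (sharedNeighbour⇒≡ (f-leaf i) (f-leaf j)
        (neighbour-edge i) (subst (λ y → A (f j) y ≡ true) (sym same) (neighbour-edge j)))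

  maximal⇒goodLeaves : ∀ {L} {f : Fin L → Fin N} → L ≡ suc (t' + t') → Injective _≡_ _≡_ f →
    (∀ i → Leaf G (f i)) → GoodLeaves G L
  maximal⇒goodLeaves refl = goodLeaves

proposition4p3 : ∀ {m : ℕ} (G : Graph (suc m)) (t : ℕ) → 1 ≤ t → InN G t →
    numDeg1 G ≤ 2 * t ∸ 1 ×
    (numDeg1 G ≡ 2 * t ∸ 1 ⇔ GoodLeaves G (2 * t ∸ 1))
proposition4p3 G ℕ.zero () _
proposition4p3 G (suc t') _ (connected , ((_ , minimal) , saturated) , no-universal) =
  bound , mk⇔ maximal⇒good good⇒maximal
  where
  open LeafBounds G connected minimal saturated no-universal

  2t∸1≡ : 2 * suc t' ∸ 1 ≡ suc (t' + t')
  2t∸1≡ = trans (cong (t' +_) (+-identityʳ (suc t'))) (+-suc t' t')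

  bound : numDeg1 G ≤ 2 * suc t' ∸ 1
  bound = subst (numDeg1 G ≤_) (sym 2t∸1≡) (leaves≤ (leaves-injective G) (leaves-leaf G))

  maximal⇒good : numDeg1 G ≡ 2 * suc t' ∸ 1 → GoodLeaves G (2 * suc t' ∸ 1)
  maximal⇒good maximal = subst (GoodLeaves G) maximal
    (maximal⇒goodLeaves (trans maximal 2t∸1≡) (leaves-injective G) (leaves-leaf G))

  good⇒maximal : GoodLeaves G (2 * suc t' ∸ 1) → numDeg1 G ≡ 2 * suc t' ∸ 1
  good⇒maximal (_ , _ , f-injective , f-leaf , _) = ≤-antisym bound (injective⇒≤-numDeg1 G f-injective f-leaf)
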